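{- Let $q$ be a power of a prime, $A=\mathbb F_q[\theta]$, $\Gamma=\operatorname{GL}_2(A)$, and let $\mathcal K$ be a commutative field extension of $\mathbb F_q$. Let $\sigma:A\to\operatorname{Mat}_{d\times d}(\mathcal K)$ be an injective $\mathbb F_q$-algebra homomorphism, and define $\rho_\sigma:\Gamma\to\operatorname{GL}_{2d}(\mathcal K)$ by $$\rho_\sigma\begin{pmatrix}a&b\\c&d\end{pmatrix}=\begin{pmatrix}\sigma(a)&\sigma(b)\\ \sigma(c)&\sigma(d)\end{pmatrix}$$ (a group representation, since the image of $\sigma$ is commutative). Then $\rho_\sigma$ is irreducible (i.e. $\mathcal K^{2d}$ has no $\rho_\sigma(\Gamma)$-stable subspace other than $0$ and $\mathcal K^{2d}$) if and only if $\sigma$ is irreducible (i.e. $\mathcal K^{d}$ has no subspace other than $0$ and $\mathcal K^d$ stable under all $\sigma(a)$, $a\in A$). -}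

module Defs where

open import Level using (Level; _⊔_; suc)
open import Data.Nat using (ℕ; _^_)
import Data.Nat as ℕ
import Data.Fin as Fin
open import Data.Nat.Primality using (Prime)
open import Data.Fin using (Fin; splitAt)
open import Data.Sum using (_⊎_; inj₁; inj₂)
open import Data.Product using (_×_; Σ; ∃; ∃-syntax; _,_)
open import Data.List using (List; []; _∷_; map)
open import Data.Unit.Polymorphic using (⊤)
open import Relation.Nullary using (¬_)
open import Relation.Binary.PropositionalEquality using (_≡_)
open import Algebra.Bundles using (CommutativeRing)
open import Algebra.Morphism.Structures using (IsRingHomomorphism)
import Algebra.Properties.Monoid.Sum as MonoidSum

record Field (c ℓ : Level) : Set (suc (c ⊔ ℓ)) where
  field
    commutativeRing : CommutativeRing c ℓ
  open CommutativeRing commutativeRing public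
  field
    0≉1     : ¬ (0# ≈ 1#)
    inverse : ∀ x → ¬ (x ≈ 0#) → ∃[ y ] (x * y ≈ 1#)

record HasCardinality {c ℓ} (F : Field c ℓ) (q : ℕ) : Set (c ⊔ ℓ) where
  open Field F
  field
    enum       : Fin q → Carrier
    surjective : ∀ x → ∃[ i ] (enum i ≈ x)
    injective  : ∀ i j → enum i ≈ enum j → i ≡ j

IsPrimePower : ℕ → Set
IsPrimePower q = ∃[ p ] ∃[ k ] (Prime p × q ≡ p ^ k)

record FieldExtension {c ℓ c' ℓ'} (F : Field c ℓ) (K : Field c' ℓ')
       : Set (c ⊔ ℓ ⊔ c' ⊔ ℓ') where
  private
    module F = Field F
    module K = Field K
  field
    ι      : F.Carrier → K.Carrier
    isHom  : IsRingHomomorphism F.rawRing K.rawRing ι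

-- The polynomial ring A = F[θ], polynomials as coefficient lists
-- (constant term first), with equality up to trailing zeros.

module Poly {c ℓ} (F : Field c ℓ) where
  open Field F

  A : Set c
  A = List Carrier

  infix 4 _≈ₚ_
  _≈ₚ_ : A → A → Set ℓ
  []       ≈ₚ []       = ⊤
  []       ≈ₚ (y ∷ ys) = (y ≈ 0#) × ([] ≈ₚ ys)
  (x ∷ xs) ≈ₚ []       = (x ≈ 0#) × (xs ≈ₚ [])
  (x ∷ xs) ≈ₚ (y ∷ ys) = (x ≈ y) × (xs ≈ₚ ys)

  infixl 6 _+ₚ_
  _+ₚ_ : A → A → A
  []       +ₚ ys       = ys
  (x ∷ xs) +ₚ []       = x ∷ xs
  (x ∷ xs) +ₚ (y ∷ ys) = (x + y) ∷ (xs +ₚ ys)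

  infixl 7 _·ₚ_
  _·ₚ_ : Carrier → A → A
  a ·ₚ p = map (a *_) p

  infixl 7 _*ₚ_
  _*ₚ_ : A → A → A
  []       *ₚ q = []
  (a ∷ p)  *ₚ q = (a ·ₚ q) +ₚ (0# ∷ (p *ₚ q))

  0ₚ 1ₚ θ : A
  0ₚ = []
  1ₚ = 1# ∷ []
  θ  = 0# ∷ 1# ∷ []

  record GL₂ : Set (c ⊔ ℓ) where
    field
      g11 g12 g21 g22 : A
      i11 i12 i21 i22 : A
      r11 : (g11 *ₚ i11) +ₚ (g12 *ₚ i21) ≈ₚ 1ₚ
      r12 : (g11 *ₚ i12) +ₚ (g12 *ₚ i22) ≈ₚ 0ₚ
      r21 : (g21 *ₚ i11) +ₚ (g22 *ₚ i21) ≈ₚ 0ₚ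
      r22 : (g21 *ₚ i12) +ₚ (g22 *ₚ i22) ≈ₚ 1ₚ
      l11 : (i11 *ₚ g11) +ₚ (i12 *ₚ g21) ≈ₚ 1ₚ
      l12 : (i11 *ₚ g12) +ₚ (i12 *ₚ g22) ≈ₚ 0ₚ
      l21 : (i21 *ₚ g11) +ₚ (i22 *ₚ g21) ≈ₚ 0ₚ
      l22 : (i21 *ₚ g12) +ₚ (i22 *ₚ g22) ≈ₚ 1ₚ

module LinAlg {c ℓ} (K : Field c ℓ) where
  open Field K
  open MonoidSum +-monoid using (sum)

  Vec : ℕ → Set c
  Vec n = Fin n → Carrier

  Mat : ℕ → Set c
  Mat n = Fin n → Fin n → Carrier

  _≈ᵥ_ : ∀ {n} → Vec n → Vec n → Set ℓ
  u ≈ᵥ v = ∀ i → u i ≈ v i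

  _≈ₘ_ : ∀ {n} → Mat n → Mat n → Set ℓ
  M ≈ₘ N = ∀ i j → M i j ≈ N i j

  0ᵥ : ∀ {n} → Vec n
  0ᵥ _ = 0#

  _+ᵥ_ : ∀ {n} → Vec n → Vec n → Vec n
  (u +ᵥ v) i = u i + v i

  _·ᵥ_ : ∀ {n} → Carrier → Vec n → Vec n
  (k ·ᵥ v) i = k * v i

  _+ₘ_ : ∀ {n} → Mat n → Mat n → Mat n
  (M +ₘ N) i j = M i j + N i j

  _·ₘ_ : ∀ {n} → Carrier → Mat n → Mat n
  (k ·ₘ M) i j = k * M i j

  _*ₘ_ : ∀ {n} → Mat n → Mat n → Mat n
  (M *ₘ N) i j = sum (λ k → M i k * N k j)

  Iₘ : ∀ {n} → Mat n
  Iₘ {ℕ.suc _} Fin.zero Fin.zero = 1#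
  Iₘ {ℕ.suc _} Fin.zero (Fin.suc _) = 0#
  Iₘ {ℕ.suc _} (Fin.suc _) Fin.zero = 0#
  Iₘ {ℕ.suc _} (Fin.suc i) (Fin.suc j) = Iₘ i j

  _⊛_ : ∀ {n} → Mat n → Vec n → Vec n
  (M ⊛ v) i = sum (λ k → M i k * v k)

  block : ∀ {d} → Mat d → Mat d → Mat d → Mat d → Mat (d ℕ.+ d)
  block {d} P Q R S i j with splitAt d i | splitAt d j
  ... | inj₁ i' | inj₁ j' = P i' j'
  ... | inj₁ i' | inj₂ j' = Q i' j'
  ... | inj₂ i' | inj₁ j' = R i' j'
  ... | inj₂ i' | inj₂ j' = S i' j'

  record Subspace (n : ℕ) : Set (Level.suc (c ⊔ ℓ)) where
    field
      _∈W        : Vec n → Set (c ⊔ ℓ)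
      respects   : ∀ {u v} → u ≈ᵥ v → u ∈W → v ∈W
      zero∈      : 0ᵥ ∈W
      +-closed   : ∀ {u v} → u ∈W → v ∈W → (u +ᵥ v) ∈W
      ·-closed   : ∀ k {v} → v ∈W → (k ·ᵥ v) ∈W

  Stable : ∀ {n} {i} {I : Set i} → (I → Mat n) → Subspace n → Set (c ⊔ ℓ ⊔ i)
  Stable M W = ∀ x v → v ∈W → (M x ⊛ v) ∈W
    where open Subspace W

  IsZeroSubspace : ∀ {n} → Subspace n → Set (c ⊔ ℓ)
  IsZeroSubspace W = ∀ v → v ∈W → v ≈ᵥ 0ᵥ
    where open Subspace W

  IsWholeSpace : ∀ {n} → Subspace n → Set (c ⊔ ℓ)
  IsWholeSpace W = ∀ v → v ∈W
    where open Subspace W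

  Irreducible : ∀ {n} {i} {I : Set i} → (I → Mat n) → Set (Level.suc (c ⊔ ℓ) ⊔ i)
  Irreducible {n} M =
    ∀ (W : Subspace n) → Stable M W →
      ¬ ((¬ IsZeroSubspace W) × (¬ IsWholeSpace W))

module _ {c ℓ c' ℓ'} {F : Field c ℓ} {K : Field c' ℓ'}
         (E : FieldExtension F K) where
  open Poly F
  open LinAlg K
  open FieldExtension E

  record IsInjectiveAlgebraHom (d : ℕ) (σ : A → Mat d)
         : Set (c ⊔ ℓ ⊔ c' ⊔ ℓ') where
    field
      cong      : ∀ {p q} → p ≈ₚ q → σ p ≈ₘ σ q
      hom-+     : ∀ p q → σ (p +ₚ q) ≈ₘ (σ p +ₘ σ q)
      hom-*     : ∀ p q → σ (p *ₚ q) ≈ₘ (σ p *ₘ σ q)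
      hom-1     : σ 1ₚ ≈ₘ Iₘ
      hom-·     : ∀ a p → σ (a ·ₚ p) ≈ₘ (ι a ·ₘ σ p)
      injective : ∀ {p q} → σ p ≈ₘ σ q → p ≈ₚ q

  ρ : ∀ {d} → (A → Mat d) → GL₂ → Mat (d ℕ.+ d)
  ρ σ g = block (σ g11) (σ g12) (σ g21) (σ g22)
    where open GL₂ g

{-# OPTIONS --safe #-}
-- Let U ⊆ K^d ⊕ K^d be ρ_σ-stable and W = {x ∣ (x, 0) ∈ U}.  Subtracting v from its image under
-- the unipotent matrix (1 b; 0 1) shows (σ(b) v₂, 0) ∈ U for every v = (v₁, v₂) ∈ U, and the
-- swap matrix (0 1; 1 0) exchanges the two halves.  Hence W is σ-stable and U = W ⊕ W, so a
-- proper nonzero ρ_σ-stable U yields a proper nonzero σ-stable W.  Conversely, a proper nonzero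
-- σ-stable W makes W ⊕ W proper, nonzero and ρ_σ-stable.
module Submission where

open import Defs
open import Level using (Level)
open import Data.Nat using (ℕ; zero; suc)
import Data.Nat as ℕ
open import Data.Fin using (splitAt; _↑ˡ_; _↑ʳ_)
import Data.Fin as Fin
open import Data.Fin.Properties using (splitAt-↑ˡ; splitAt-↑ʳ; join-splitAt)
open import Data.Sum using (inj₁; inj₂; [_,_]′)
open import Data.Product using (_×_; _,_; proj₁)
open import Data.List using ([]; _∷_)
open import Data.Unit.Polymorphic using (tt)
open import Relation.Nullary using (¬_)
open import Relation.Binary.PropositionalEquality as ≡ using (_≡_)
open import Function.Bundles using (_⇔_; mk⇔)
open import Algebra.Bundles using (Ring)
import Algebra.Properties.Ring as RingProperties
import Algebra.Properties.Monoid.Sum as MonoidSum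
import Relation.Binary.Reasoning.Setoid as SetoidReasoning

module ScalarProperties {c ℓ} (R : Ring c ℓ) where
  open Ring R
  open RingProperties R using (-1*x≈-x)
  open SetoidReasoning setoid

  x+-1*x≈0 : ∀ x → x + - 1# * x ≈ 0#
  x+-1*x≈0 x = trans (+-cong refl (-1*x≈-x x)) (-‿inverseʳ x)

  x+y+-1*x≈y : ∀ x y → (x + y) + - 1# * x ≈ y
  x+y+-1*x≈y x y = begin
    (x + y) + - 1# * x   ≈⟨ +-cong (+-comm x y) refl ⟩
    (y + x) + - 1# * x   ≈⟨ +-assoc y x _ ⟩
    y + (x + - 1# * x)   ≈⟨ +-cong refl (x+-1*x≈0 x) ⟩
    y + 0#               ≈⟨ +-identityʳ y ⟩
    y                    ∎

module PolyProperties {c ℓ} (F : Field c ℓ) where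
  open Field F
  open Poly F
  open ScalarProperties ring using (x+-1*x≈0)

  coeff : A → ℕ → Carrier
  coeff []       _       = 0#
  coeff (x ∷ xs) zero    = x
  coeff (x ∷ xs) (suc n) = coeff xs n

  coeff⇒≈ₚ : ∀ p q → (∀ n → coeff p n ≈ coeff q n) → p ≈ₚ q
  coeff⇒≈ₚ []       []       h = tt
  coeff⇒≈ₚ []       (y ∷ ys) h = sym (h 0) , coeff⇒≈ₚ [] ys (λ n → h (suc n))
  coeff⇒≈ₚ (x ∷ xs) []       h = h 0 , coeff⇒≈ₚ xs [] (λ n → h (suc n))
  coeff⇒≈ₚ (x ∷ xs) (y ∷ ys) h = h 0 , coeff⇒≈ₚ xs ys (λ n → h (suc n))

  coeff-+ₚ : ∀ p q n → coeff (p +ₚ q) n ≈ coeff p n + coeff q n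
  coeff-+ₚ []       q        n       = sym (+-identityˡ _)
  coeff-+ₚ (x ∷ xs) []       zero    = sym (+-identityʳ _)
  coeff-+ₚ (x ∷ xs) []       (suc n) = sym (+-identityʳ _)
  coeff-+ₚ (x ∷ xs) (y ∷ ys) zero    = refl
  coeff-+ₚ (x ∷ xs) (y ∷ ys) (suc n) = coeff-+ₚ xs ys n

  coeff-·ₚ : ∀ a p n → coeff (a ·ₚ p) n ≈ a * coeff p n
  coeff-·ₚ a []       n       = sym (zeroʳ a)
  coeff-·ₚ a (x ∷ xs) zero    = refl
  coeff-·ₚ a (x ∷ xs) (suc n) = coeff-·ₚ a xs n

  coeff-1ₚ*ₚ : ∀ p n → coeff (1ₚ *ₚ p) n ≈ coeff p n
  coeff-1ₚ*ₚ p n = begin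
    coeff (1ₚ *ₚ p) n                           ≈⟨ coeff-+ₚ (1# ·ₚ p) (0# ∷ []) n ⟩
    coeff (1# ·ₚ p) n + coeff (0# ∷ []) n       ≈⟨ +-cong (coeff-·ₚ 1# p n) (coeff-0#∷[] n) ⟩
    1# * coeff p n + 0#                         ≈⟨ +-identityʳ _ ⟩
    1# * coeff p n                              ≈⟨ *-identityˡ _ ⟩
    coeff p n                                   ∎
    where
    open SetoidReasoning setoid
    coeff-0#∷[] : ∀ n → coeff (0# ∷ []) n ≈ 0#
    coeff-0#∷[] zero    = refl
    coeff-0#∷[] (suc n) = refl

  coeff-*ₚ1ₚ : ∀ p n → coeff (p *ₚ 1ₚ) n ≈ coeff p n
  coeff-*ₚ1ₚ []      n       = refl
  coeff-*ₚ1ₚ (a ∷ p) zero    = trans (+-identityʳ _) (*-identityʳ a)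
  coeff-*ₚ1ₚ (a ∷ p) (suc n) = coeff-*ₚ1ₚ p n

  coeff-*ₚ0ₚ : ∀ p n → coeff (p *ₚ 0ₚ) n ≈ 0#
  coeff-*ₚ0ₚ []      n       = refl
  coeff-*ₚ0ₚ (a ∷ p) zero    = refl
  coeff-*ₚ0ₚ (a ∷ p) (suc n) = coeff-*ₚ0ₚ p n

  1ₚ*ₚ1ₚ≈ₚ1ₚ : 1ₚ *ₚ 1ₚ ≈ₚ 1ₚ
  1ₚ*ₚ1ₚ≈ₚ1ₚ = coeff⇒≈ₚ (1ₚ *ₚ 1ₚ) 1ₚ (coeff-1ₚ*ₚ 1ₚ)

  1ₚ*ₚ0ₚ≈ₚ0ₚ : 1ₚ *ₚ 0ₚ ≈ₚ 0ₚ
  1ₚ*ₚ0ₚ≈ₚ0ₚ = coeff⇒≈ₚ (1ₚ *ₚ 0ₚ) 0ₚ (coeff-*ₚ0ₚ 1ₚ)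

  1ₚ*ₚ1ₚ+ₚp*ₚ0ₚ≈ₚ1ₚ : ∀ p → (1ₚ *ₚ 1ₚ) +ₚ (p *ₚ 0ₚ) ≈ₚ 1ₚ
  1ₚ*ₚ1ₚ+ₚp*ₚ0ₚ≈ₚ1ₚ p = coeff⇒≈ₚ _ _ λ n →
    trans (coeff-+ₚ (1ₚ *ₚ 1ₚ) (p *ₚ 0ₚ) n)
          (trans (+-cong (coeff-1ₚ*ₚ 1ₚ n) (coeff-*ₚ0ₚ p n)) (+-identityʳ _))

  unipotent : A → GL₂
  unipotent b = record
    { g11 = 1ₚ ; g12 = b  ; g21 = 0ₚ ; g22 = 1ₚ
    ; i11 = 1ₚ ; i12 = -b ; i21 = 0ₚ ; i22 = 1ₚ
    ; r11 = 1ₚ*ₚ1ₚ+ₚp*ₚ0ₚ≈ₚ1ₚ b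
    ; r12 = coeff⇒≈ₚ _ _ λ n →
        trans (coeff-+ₚ (1ₚ *ₚ -b) (b *ₚ 1ₚ) n)
          (trans (+-cong (trans (coeff-1ₚ*ₚ -b n) (coeff-·ₚ (- 1#) b n)) (coeff-*ₚ1ₚ b n))
                 (trans (+-comm _ _) (x+-1*x≈0 _)))
    ; r21 = 1ₚ*ₚ0ₚ≈ₚ0ₚ
    ; r22 = 1ₚ*ₚ1ₚ≈ₚ1ₚ
    ; l11 = 1ₚ*ₚ1ₚ+ₚp*ₚ0ₚ≈ₚ1ₚ -b
    ; l12 = coeff⇒≈ₚ _ _ λ n →
        trans (coeff-+ₚ (1ₚ *ₚ b) (-b *ₚ 1ₚ) n)
          (trans (+-cong (coeff-1ₚ*ₚ b n) (trans (coeff-*ₚ1ₚ -b n) (coeff-·ₚ (- 1#) b n)))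
                 (x+-1*x≈0 _))
    ; l21 = 1ₚ*ₚ0ₚ≈ₚ0ₚ
    ; l22 = 1ₚ*ₚ1ₚ≈ₚ1ₚ
    }
    where
    -b : A
    -b = (- 1#) ·ₚ b

  swap : GL₂
  swap = record
    { g11 = 0ₚ ; g12 = 1ₚ ; g21 = 1ₚ ; g22 = 0ₚ
    ; i11 = 0ₚ ; i12 = 1ₚ ; i21 = 1ₚ ; i22 = 0ₚ
    ; r11 = 1ₚ*ₚ1ₚ≈ₚ1ₚ ; r12 = 1ₚ*ₚ0ₚ≈ₚ0ₚ ; r21 = 1ₚ*ₚ0ₚ≈ₚ0ₚ ; r22 = 1ₚ*ₚ1ₚ≈ₚ1ₚ
    ; l11 = 1ₚ*ₚ1ₚ≈ₚ1ₚ ; l12 = 1ₚ*ₚ0ₚ≈ₚ0ₚ ; l21 = 1ₚ*ₚ0ₚ≈ₚ0ₚ ; l22 = 1ₚ*ₚ1ₚ≈ₚ1ₚ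
    }

module MatrixProperties {c ℓ} (K : Field c ℓ) where
  open Field K
  open LinAlg K
  open MonoidSum +-monoid using (sum; sum-cong-≋; sum-replicate-zero)

  sum-≈0 : ∀ {n} (f : Vec n) → f ≈ᵥ 0ᵥ → sum f ≈ 0#
  sum-≈0 {n} f f≈0 = trans (sum-cong-≋ f≈0) (sum-replicate-zero n)

  sum-splitAt : ∀ m {n} (f : Vec (m ℕ.+ n)) →
                sum f ≈ sum (λ i → f (i ↑ˡ n)) + sum (λ i → f (m ↑ʳ i))
  sum-splitAt zero    f = sym (+-identityˡ _)
  sum-splitAt (suc m) f =
    trans (+-cong refl (sum-splitAt m (λ i → f (Fin.suc i)))) (sym (+-assoc _ _ _))

  ⊛-cong : ∀ {n} {M N : Mat n} {u v : Vec n} → M ≈ₘ N → u ≈ᵥ v → (M ⊛ u) ≈ᵥ (N ⊛ v)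
  ⊛-cong M≈N u≈v i = sum-cong-≋ (λ k → *-cong (M≈N i k) (u≈v k))

  Iₘ-⊛ : ∀ {n} (v : Vec n) → (Iₘ ⊛ v) ≈ᵥ v
  Iₘ-⊛ {suc n} v Fin.zero =
    trans (+-cong (*-identityˡ _) (sum-≈0 _ (λ k → zeroˡ (v (Fin.suc k))))) (+-identityʳ _)
  Iₘ-⊛ {suc n} v (Fin.suc i) =
    trans (+-cong (zeroˡ _) refl) (trans (+-identityˡ _) (Iₘ-⊛ (λ k → v (Fin.suc k)) i))

  zero-⊛ : ∀ {n} {M : Mat n} → M ≈ₘ (λ _ _ → 0#) → ∀ v → (M ⊛ v) ≈ᵥ 0ᵥ
  zero-⊛ M≈0 v i = sum-≈0 _ (λ k → trans (*-cong (M≈0 i k) refl) (zeroˡ _))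

module BlockVectors {c ℓ} (K : Field c ℓ) (d : ℕ) where
  open Field K
  open LinAlg K
  open MonoidSum +-monoid using (sum; sum-cong-≋)
  open MatrixProperties K using (sum-splitAt)

  top bot : Vec (d ℕ.+ d) → Vec d
  top v i = v (i ↑ˡ d)
  bot v i = v (d ↑ʳ i)

  stack : Vec d → Vec d → Vec (d ℕ.+ d)
  stack x y j = [ x , y ]′ (splitAt d j)

  top-stack : ∀ x y → top (stack x y) ≈ᵥ x
  top-stack x y i rewrite splitAt-↑ˡ d i d = refl

  bot-stack : ∀ x y → bot (stack x y) ≈ᵥ y
  bot-stack x y i rewrite splitAt-↑ʳ d d i = refl

  stack-cong : ∀ {x x' y y'} → x ≈ᵥ x' → y ≈ᵥ y' → stack x y ≈ᵥ stack x' y'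
  stack-cong x≈x' y≈y' j with splitAt d j
  ... | inj₁ i = x≈x' i
  ... | inj₂ i = y≈y' i

  ≈ᵥ-stack : ∀ {v x y} → top v ≈ᵥ x → bot v ≈ᵥ y → v ≈ᵥ stack x y
  ≈ᵥ-stack top≈x bot≈y j with splitAt d j | join-splitAt d d j
  ... | inj₁ i | ≡.refl = top≈x i
  ... | inj₂ i | ≡.refl = bot≈y i

  stack-top-bot : ∀ v → stack (top v) (bot v) ≈ᵥ v
  stack-top-bot v j = sym (≈ᵥ-stack (λ _ → refl) (λ _ → refl) j)

  top-block-⊛ : ∀ P Q R S v → top (block P Q R S ⊛ v) ≈ᵥ ((P ⊛ top v) +ᵥ (Q ⊛ bot v))
  top-block-⊛ P Q R S v i =
    trans (sum-splitAt d _)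
      (+-cong (sum-cong-≋ (λ k → reflexive (≡.cong (_* v (k ↑ˡ d)) (entry-↑ˡ k))))
              (sum-cong-≋ (λ k → reflexive (≡.cong (_* v (d ↑ʳ k)) (entry-↑ʳ k)))))
    where
    entry-↑ˡ : ∀ k → block P Q R S (i ↑ˡ d) (k ↑ˡ d) ≡ P i k
    entry-↑ˡ k rewrite splitAt-↑ˡ d i d | splitAt-↑ˡ d k d = ≡.refl
    entry-↑ʳ : ∀ k → block P Q R S (i ↑ˡ d) (d ↑ʳ k) ≡ Q i k
    entry-↑ʳ k rewrite splitAt-↑ˡ d i d | splitAt-↑ʳ d d k = ≡.refl

  bot-block-⊛ : ∀ P Q R S v → bot (block P Q R S ⊛ v) ≈ᵥ ((R ⊛ top v) +ᵥ (S ⊛ bot v))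
  bot-block-⊛ P Q R S v i =
    trans (sum-splitAt d _)
      (+-cong (sum-cong-≋ (λ k → reflexive (≡.cong (_* v (k ↑ˡ d)) (entry-↑ˡ k))))
              (sum-cong-≋ (λ k → reflexive (≡.cong (_* v (d ↑ʳ k)) (entry-↑ʳ k)))))
    where
    entry-↑ˡ : ∀ k → block P Q R S (d ↑ʳ i) (k ↑ˡ d) ≡ R i k
    entry-↑ˡ k rewrite splitAt-↑ʳ d d i | splitAt-↑ˡ d k d = ≡.refl
    entry-↑ʳ : ∀ k → block P Q R S (d ↑ʳ i) (d ↑ʳ k) ≡ S i k
    entry-↑ʳ k rewrite splitAt-↑ʳ d d i | splitAt-↑ʳ d d k = ≡.refl

  stack-+ᵥ : ∀ x y x' y' → (stack x y +ᵥ stack x' y') ≈ᵥ stack (x +ᵥ x') (y +ᵥ y')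
  stack-+ᵥ x y x' y' j with splitAt d j
  ... | inj₁ i = refl
  ... | inj₂ i = refl

  stack-·ᵥ : ∀ k x y → (k ·ᵥ stack x y) ≈ᵥ stack (k ·ᵥ x) (k ·ᵥ y)
  stack-·ᵥ k x y j with splitAt d j
  ... | inj₁ i = refl
  ... | inj₂ i = refl

  0ᵥ-stack : 0ᵥ ≈ᵥ stack 0ᵥ 0ᵥ
  0ᵥ-stack j with splitAt d j
  ... | inj₁ i = refl
  ... | inj₂ i = refl

  infixr 5 _⊕ˢ_
  _⊕ˢ_ : Subspace d → Subspace d → Subspace (d ℕ.+ d)
  V ⊕ˢ W = record
    { _∈W      = λ v → top v ∈V × bot v ∈W
    ; respects = λ u≈v (p , q) → respV (λ i → u≈v (i ↑ˡ d)) p , respW (λ i → u≈v (d ↑ʳ i)) q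
    ; zero∈    = zeroV , zeroW
    ; +-closed = λ (p , q) (p' , q') → +V p p' , +W q q'
    ; ·-closed = λ k (p , q) → ·V k p , ·W k q
    }
    where
    open Subspace V renaming (_∈W to _∈V; respects to respV; zero∈ to zeroV;
                              +-closed to +V; ·-closed to ·V)
    open Subspace W renaming (respects to respW; zero∈ to zeroW; +-closed to +W; ·-closed to ·W)

  stack∈⊕ˢ : ∀ {V W x y} → Subspace._∈W V x → Subspace._∈W W y →
             Subspace._∈W (V ⊕ˢ W) (stack x y)
  stack∈⊕ˢ {V} {W} {x} {y} x∈V y∈W =
    Subspace.respects V (λ i → sym (top-stack x y i)) x∈V ,
    Subspace.respects W (λ i → sym (bot-stack x y i)) y∈W

  topSlice : Subspace (d ℕ.+ d) → Subspace d
  topSlice U = record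
    { _∈W      = λ x → stack x 0ᵥ ∈U
    ; respects = λ x≈y → respU (stack-cong x≈y (λ _ → refl))
    ; zero∈    = respU 0ᵥ-stack zeroU
    ; +-closed = λ {x} {y} p q →
        respU (λ j → trans (stack-+ᵥ x 0ᵥ y 0ᵥ j) (stack-cong (λ _ → refl) (λ _ → +-identityʳ 0#) j))
              (+U p q)
    ; ·-closed = λ k {x} p →
        respU (λ j → trans (stack-·ᵥ k x 0ᵥ j) (stack-cong (λ _ → refl) (λ _ → zeroʳ k) j))
              (·U k p)
    }
    where
    open Subspace U renaming (_∈W to _∈U; respects to respU; zero∈ to zeroU;
                              +-closed to +U; ·-closed to ·U)

module Representation {c ℓ c' ℓ'} {F : Field c ℓ} {K : Field c' ℓ'}
         (E : FieldExtension F K) (d : ℕ) (σ : Poly.A F → LinAlg.Mat K d)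
         (σ-hom : IsInjectiveAlgebraHom E d σ) where
  open Field K
  open LinAlg K
  open Poly F using (0ₚ; 1ₚ)
  open PolyProperties F using (unipotent; swap)
  open ScalarProperties ring using (x+-1*x≈0; x+y+-1*x≈y)
  open MatrixProperties K using (⊛-cong; Iₘ-⊛; zero-⊛)
  open BlockVectors K d
  open IsInjectiveAlgebraHom σ-hom using (hom-+; hom-1)
  open RingProperties ring using (x+x≈x⇒x≈0)

  σ-0ₚ-⊛ : ∀ v → (σ 0ₚ ⊛ v) ≈ᵥ 0ᵥ
  σ-0ₚ-⊛ = zero-⊛ (λ i j → x+x≈x⇒x≈0 _ (sym (hom-+ 0ₚ 0ₚ i j)))

  σ-1ₚ-⊛ : ∀ v → (σ 1ₚ ⊛ v) ≈ᵥ v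
  σ-1ₚ-⊛ v i = trans (⊛-cong hom-1 (λ _ → refl) i) (Iₘ-⊛ v i)

  top-ρ-unipotent-⊛ : ∀ b v → top (ρ E σ (unipotent b) ⊛ v) ≈ᵥ (top v +ᵥ (σ b ⊛ bot v))
  top-ρ-unipotent-⊛ b v i =
    trans (top-block-⊛ _ _ _ _ v i) (+-cong (σ-1ₚ-⊛ (top v) i) refl)

  bot-ρ-unipotent-⊛ : ∀ b v → bot (ρ E σ (unipotent b) ⊛ v) ≈ᵥ bot v
  bot-ρ-unipotent-⊛ b v i =
    trans (bot-block-⊛ _ _ _ _ v i)
          (trans (+-cong (σ-0ₚ-⊛ (top v) i) (σ-1ₚ-⊛ (bot v) i)) (+-identityˡ _))

  top-ρ-swap-⊛ : ∀ v → top (ρ E σ swap ⊛ v) ≈ᵥ bot v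
  top-ρ-swap-⊛ v i =
    trans (top-block-⊛ _ _ _ _ v i)
          (trans (+-cong (σ-0ₚ-⊛ (top v) i) (σ-1ₚ-⊛ (bot v) i)) (+-identityˡ _))

  bot-ρ-swap-⊛ : ∀ v → bot (ρ E σ swap ⊛ v) ≈ᵥ top v
  bot-ρ-swap-⊛ v i =
    trans (bot-block-⊛ _ _ _ _ v i)
          (trans (+-cong (σ-1ₚ-⊛ (top v) i) (σ-0ₚ-⊛ (bot v) i)) (+-identityʳ _))

  ⊕ˢ-stable : ∀ {W} → Stable σ W → Stable (ρ E σ) (W ⊕ˢ W)
  ⊕ˢ-stable {W} W-stable g v (p , q) =
    respects (λ i → sym (top-block-⊛ _ _ _ _ v i)) (+-closed (W-stable g11 _ p) (W-stable g12 _ q)) ,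
    respects (λ i → sym (bot-block-⊛ _ _ _ _ v i)) (+-closed (W-stable g21 _ p) (W-stable g22 _ q))
    where
    open Poly.GL₂ g
    open Subspace W

  ρ-irreducible⇒σ-irreducible : Irreducible (ρ E σ) → Irreducible σ
  ρ-irreducible⇒σ-irreducible ρ-irr W W-stable (W≉0 , W≉⊤) =
    ρ-irr (W ⊕ˢ W) (⊕ˢ-stable {W} W-stable) (W⊕W≉0 , W⊕W≉⊤)
    where
    open Subspace W
    W⊕W≉0 : ¬ IsZeroSubspace (W ⊕ˢ W)
    W⊕W≉0 W⊕W≈0 = W≉0 λ x x∈W i →
      trans (sym (top-stack x 0ᵥ i)) (W⊕W≈0 (stack x 0ᵥ) (stack∈⊕ˢ {W} {W} x∈W zero∈) (i ↑ˡ d))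
    W⊕W≉⊤ : ¬ IsWholeSpace (W ⊕ˢ W)
    W⊕W≉⊤ W⊕W≈⊤ = W≉⊤ λ x → respects (top-stack x x) (proj₁ (W⊕W≈⊤ (stack x x)))

  module ρ-StableSubspace (U : Subspace (d ℕ.+ d)) (U-stable : Stable (ρ E σ) U) where
    open Subspace U renaming (_∈W to _∈U; respects to respU; +-closed to +U; ·-closed to ·U)
    open Subspace (topSlice U) using (_∈W) renaming (respects to respW)

    σ-bot∈topSlice : ∀ {v} → v ∈U → ∀ b → (σ b ⊛ bot v) ∈W
    σ-bot∈topSlice {v} v∈U b =
      respU (≈ᵥ-stack top≈ bot≈) (+U (U-stable (unipotent b) v v∈U) (·U (- 1#) v∈U))
      where
      top≈ : ∀ i → (ρ E σ (unipotent b) ⊛ v) (i ↑ˡ d) + - 1# * top v i ≈ (σ b ⊛ bot v) i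
      top≈ i = trans (+-cong (top-ρ-unipotent-⊛ b v i) refl) (x+y+-1*x≈y _ _)
      bot≈ : ∀ i → (ρ E σ (unipotent b) ⊛ v) (d ↑ʳ i) + - 1# * bot v i ≈ 0#
      bot≈ i = trans (+-cong (bot-ρ-unipotent-⊛ b v i) refl) (x+-1*x≈0 _)

    stack-bot-top∈U : ∀ {v} → v ∈U → stack (bot v) (top v) ∈U
    stack-bot-top∈U {v} v∈U =
      respU (≈ᵥ-stack (top-ρ-swap-⊛ v) (bot-ρ-swap-⊛ v)) (U-stable swap v v∈U)

    bot∈topSlice : ∀ {v} → v ∈U → bot v ∈W
    bot∈topSlice {v} v∈U = respW (σ-1ₚ-⊛ (bot v)) (σ-bot∈topSlice v∈U 1ₚ)

    top∈topSlice : ∀ {v} → v ∈U → top v ∈W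
    top∈topSlice {v} v∈U =
      respW (bot-stack (bot v) (top v)) (bot∈topSlice (stack-bot-top∈U v∈U))

    stack-0ᵥ∈U : ∀ {y} → y ∈W → stack 0ᵥ y ∈U
    stack-0ᵥ∈U {y} y∈W =
      respU (stack-cong (bot-stack y 0ᵥ) (top-stack y 0ᵥ)) (stack-bot-top∈U y∈W)

    halves∈topSlice⇒∈U : ∀ {v} → top v ∈W → bot v ∈W → v ∈U
    halves∈topSlice⇒∈U {v} top∈W bot∈W = respU v≈ (+U top∈W (stack-0ᵥ∈U bot∈W))
      where
      v≈ : (stack (top v) 0ᵥ +ᵥ stack 0ᵥ (bot v)) ≈ᵥ v
      v≈ j = trans (stack-+ᵥ (top v) 0ᵥ 0ᵥ (bot v) j)
                   (trans (stack-cong (λ _ → +-identityʳ _) (λ _ → +-identityˡ _) j)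
                          (stack-top-bot v j))

    topSlice-stable : Stable σ (topSlice U)
    topSlice-stable b y y∈W =
      respW (⊛-cong {M = σ b} (λ _ _ → refl) (bot-stack 0ᵥ y)) (σ-bot∈topSlice (stack-0ᵥ∈U y∈W) b)

  σ-irreducible⇒ρ-irreducible : Irreducible σ → Irreducible (ρ E σ)
  σ-irreducible⇒ρ-irreducible σ-irr U U-stable (U≉0 , U≉⊤) =
    σ-irr (topSlice U) topSlice-stable (W≉0 , W≉⊤)
    where
    open ρ-StableSubspace U U-stable
    W≉0 : ¬ IsZeroSubspace (topSlice U)
    W≉0 W≈0 = U≉0 λ v v∈U j →
      trans (≈ᵥ-stack (W≈0 _ (top∈topSlice v∈U)) (W≈0 _ (bot∈topSlice v∈U)) j) (sym (0ᵥ-stack j))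
    W≉⊤ : ¬ IsWholeSpace (topSlice U)
    W≉⊤ W≈⊤ = U≉⊤ λ v → halves∈topSlice⇒∈U (W≈⊤ (top v)) (W≈⊤ (bot v))

mainTheorem2 : ∀ {c ℓ c' ℓ' : Level} (q : ℕ) → IsPrimePower q →
    (Fq : Field c ℓ) → HasCardinality Fq q →
    (K : Field c' ℓ') (E : FieldExtension Fq K) →
    (d : ℕ) (σ : Poly.A Fq → LinAlg.Mat K d) →
    IsInjectiveAlgebraHom E d σ →
    LinAlg.Irreducible K (ρ E σ) ⇔ LinAlg.Irreducible K σ
mainTheorem2 _ _ _ _ _ E d σ σ-hom =
  mk⇔ ρ-irreducible⇒σ-irreducible σ-irreducible⇒ρ-irreducible
  where open Representation E d σ σ-hom
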